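{- For $n\ge 5$, a set of $n$ positive integers has exactly $2^{n-1}$ divisors if and only if it is an anti-pencil. A set of four positive integers has exactly $8$ divisors if and only if it is an anti-pencil or of the form $\{a,2a,3a,6a\}$ for some positive integer $a$.
   Context: For a finite set $A$ of positive integers, write $\sum A$ for the sum of its elements (with $\sum\emptyset=0$). A subset $B\subseteq A$ is a divisor of $A$ if $\sum B$ divides $\sum A$ (so the empty set is not a divisor of nonempty $A$, while $A$ is). If $A=\{a_1,\dots,a_n\}$ with $a_1<\dots<a_n$, then $A$ is an anti-pencil if the set of divisors of $A$ consists exactly of all non-empty subsets of $A\setminus\{a_n\}$ together with $A$ itself. -}

module Defs where

open import Data.Nat using (ℕ; zero; suc; _+_; _*_; _<_; _≤_)
open import Data.Nat.Divisibility using (_∣_; _∣?_)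
open import Data.Bool using (Bool; true; false)
open import Data.Fin using (Fin; zero; suc; fromℕ)
open import Data.Fin.Subset using (Subset; _∈_; _∉_; Nonempty; ⊤)
open import Data.Vec using (Vec; []; _∷_)
open import Data.List using (List; []; _∷_; map; _++_; length; filter)
open import Data.Product using (_×_)
open import Data.Sum using (_⊎_)
open import Relation.Binary.PropositionalEquality using (_≡_)
open import Function.Bundles using (_⇔_)

-- A finite set A = {a_0 < a_1 < ... < a_(n-1)} of positive integers is
-- represented by its (unique) strictly increasing enumeration a : Fin n → ℕ.
IsPosSet : {n : ℕ} → (Fin n → ℕ) → Set
IsPosSet {n} a = (∀ i → 0 < a i) × (∀ (i j : Fin n) → Data.Fin._<_ i j → a i < a j)

sumSub : {n : ℕ} → (Fin n → ℕ) → Subset n → ℕ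
sumSub a [] = 0
sumSub a (true ∷ B) = a zero + sumSub (λ i → a (suc i)) B
sumSub a (false ∷ B) = sumSub (λ i → a (suc i)) B

sumAll : {n : ℕ} → (Fin n → ℕ) → ℕ
sumAll {n} a = sumSub a ⊤

IsDivisor : {n : ℕ} → (Fin n → ℕ) → Subset n → Set
IsDivisor a B = sumSub a B ∣ sumAll a

allSubsets : (n : ℕ) → List (Subset n)
allSubsets zero = [] ∷ []
allSubsets (suc n) = map (true ∷_) (allSubsets n) ++ map (false ∷_) (allSubsets n)

numDivisors : {n : ℕ} → (Fin n → ℕ) → ℕ
numDivisors {n} a = length (filter (λ B → sumSub a B ∣? sumAll a) (allSubsets n))

AntiPencil : {m : ℕ} → (Fin (suc m) → ℕ) → Set
AntiPencil {m} a =
  ∀ (B : Subset (suc m)) →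
    IsDivisor a B ⇔ ((Nonempty B × fromℕ m ∉ B) ⊎ B ≡ ⊤)

-- Let S = ΣA. For B ⊆ A the complementary pair {B, A∖B} contains 0, 1 or 2 divisors, and 2 only when
-- ΣB = S/2, since a proper divisor of S is at most S/2. Summing over all B counts every divisor twice, so
-- A has 2^(n-1) divisors iff the pair counts average 1.
--
-- If the largest element exceeds S/2 there are no halves, so every pair contains exactly one divisor;
-- a subset containing the maximum but not all of A has its sum in (S/2, S), so this is exactly the
-- anti-pencil condition.
--
-- Otherwise choose an element u such that toggling u sends every half to a pair without divisors
-- (u = a₀ unless 6a₀ = S; a₁ or a₂ in the remaining small cases). The pair counts of B and B △ {u} then
-- add up to at most 2, hence to exactly 2 when the number of divisors is 2^(n-1). Starting from a subset
-- with sum in (S/3, 2S/3) this yields a half avoiding u, and adding or removing single elements shows that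
-- the maximum is S/2 and every element other than u is at least S/4 or equal to S/6. For n ≥ 5 such
-- elements weigh more than S; for n = 4 they force A = {a, 2a, 3a, 6a}.

module Submission where

open import Defs
open import Data.Nat
open import Data.Nat.Properties
open import Algebra.Properties.CommutativeSemigroup +-commutativeSemigroup using (x∙yz≈y∙xz; xy∙z≈yz∙x; interchange)
open import Data.Nat.Divisibility using (_∣_; _∣?_; divides; ∣-refl; 0∣⇒≡0; *-cancelʳ-∣; *-monoˡ-∣)
open import Data.Nat.Tactic.RingSolver using (solve-∀)
open import Data.Bool using (true; false; not; if_then_else_)
open import Data.Bool.Properties using (not-involutive) renaming (_≟_ to _≟ᵇ_)
open import Data.Fin using (Fin; zero; suc; fromℕ)
import Data.Fin.Properties as Fin
open import Data.Fin.Subset using (Subset; ∁; ⊤; ⊥; ⁅_⁆; _∈_; _∉_; Nonempty; inside; outside)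
open import Data.Fin.Subset.Properties using (_∈?_; x∈p⇒x∉∁p; x∉p⇒x∈∁p; ∈⊤; x∈⁅y⁆⇒x≡y)
open import Data.Vec using ([]; _∷_; here; there; _[_]%=_; lookup)
open import Data.Vec.Properties using (updateAt-updateAt-local; updateAt-id; map-updateAt; ≡-dec)
open import Data.List using ([]; _∷_; map; _++_; length; filter)
open import Data.List.Properties using (filter-++; length-++)
open import Relation.Unary using (Pred; Decidable)
open import Data.Product using (∃; ∃-syntax; _×_; _,_; proj₁; proj₂)
open import Data.Sum using (_⊎_; inj₁; inj₂; [_,_])
open import Data.Empty using (⊥-elim) renaming (⊥ to Empty)
open import Relation.Nullary using (¬_; yes; no; does; contradiction)
open import Relation.Binary.Definitions using (tri<; tri≈; tri>)
open import Relation.Binary.PropositionalEquality using (_≡_; _≢_; refl; sym; trans; cong; cong₂; subst; subst₂; ≢-sym; module ≡-Reasoning)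
open import Function using (_∘_; case_of_)
open import Level using (0ℓ)
open import Function.Bundles using (_⇔_; mk⇔; Equivalence)
open import Data.Nat.DivMod using (_/_; _%_; m≡m%n+[m/n]*n; m%n<n; m/n<m; m/n*n≤m)

-- Subsets and subset sums

toggle : ∀ {n} → Subset n → Fin n → Subset n
toggle B i = B [ i ]%= not

toggle-involutive : ∀ {n} (B : Subset n) i → toggle (toggle B i) i ≡ B
toggle-involutive B i = trans (updateAt-updateAt-local i B (not-involutive _)) (updateAt-id i B)

∁-toggle : ∀ {n} (B : Subset n) i → ∁ (toggle B i) ≡ toggle (∁ B) i
∁-toggle B i = map-updateAt B i refl

∁-involutive : ∀ {n} (B : Subset n) → ∁ (∁ B) ≡ B
∁-involutive []      = refl
∁-involutive (b ∷ B) = cong₂ _∷_ (not-involutive b) (∁-involutive B)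

∈⇒∉-toggle : ∀ {n} {B : Subset n} {i} → i ∈ B → i ∉ toggle B i
∈⇒∉-toggle here        ()
∈⇒∉-toggle (there i∈B) (there i∈B′) = ∈⇒∉-toggle i∈B i∈B′

∈-toggle⁻ : ∀ {n} {B : Subset n} {i j} → j ≢ i → j ∈ toggle B i → j ∈ B
∈-toggle⁻ {B = _ ∷ _} {zero}  {zero}  j≢i _           = contradiction refl j≢i
∈-toggle⁻ {B = _ ∷ _} {zero}  {suc j} j≢i (there j∈B) = there j∈B
∈-toggle⁻ {B = _ ∷ _} {suc i} {zero}  j≢i here        = here
∈-toggle⁻ {B = _ ∷ _} {suc i} {suc j} j≢i (there j∈B) = there (∈-toggle⁻ (j≢i ∘ cong suc) j∈B)

∉-toggle : ∀ {n} {B : Subset n} {i j} → j ≢ i → j ∉ B → j ∉ toggle B i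
∉-toggle j≢i j∉B = j∉B ∘ ∈-toggle⁻ j≢i

≢⊤⇒∃∉ : ∀ {n} {B : Subset n} → B ≢ ⊤ → ∃ λ i → i ∉ B
≢⊤⇒∃∉ {B = []}          B≢⊤ = contradiction refl B≢⊤
≢⊤⇒∃∉ {B = outside ∷ B} B≢⊤ = zero , λ ()
≢⊤⇒∃∉ {B = inside ∷ B}  B≢⊤ with ≢⊤⇒∃∉ (B≢⊤ ∘ cong (inside ∷_))
... | i , i∉B = suc i , λ { (there i∈B) → i∉B i∈B }

∈⇒∁≢⊤ : ∀ {n} {B : Subset n} {i} → i ∈ B → ∁ B ≢ ⊤
∈⇒∁≢⊤ {i = i} i∈B ∁B≡⊤ = x∈p⇒x∉∁p i∈B (subst (i ∈_) (sym ∁B≡⊤) ∈⊤)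

sumSub-⊥ : ∀ {n} (a : Fin n → ℕ) → sumSub a ⊥ ≡ 0
sumSub-⊥ {zero}  a = refl
sumSub-⊥ {suc n} a = sumSub-⊥ (a ∘ suc)

sumSub-⁅⁆ : ∀ {n} (a : Fin n → ℕ) i → sumSub a ⁅ i ⁆ ≡ a i
sumSub-⁅⁆ a zero    = trans (cong (a zero +_) (sumSub-⊥ (a ∘ suc))) (+-identityʳ (a zero))
sumSub-⁅⁆ a (suc i) = sumSub-⁅⁆ (a ∘ suc) i

sumSub+sumSub-∁ : ∀ {n} (a : Fin n → ℕ) B → sumSub a B + sumSub a (∁ B) ≡ sumAll a
sumSub+sumSub-∁ a []            = refl
sumSub+sumSub-∁ a (inside ∷ B)  = trans (+-assoc (a zero) _ _) (cong (a zero +_) (sumSub+sumSub-∁ (a ∘ suc) B))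
sumSub+sumSub-∁ a (outside ∷ B) = trans (x∙yz≈y∙xz (sumSub (a ∘ suc) B) (a zero) _)
                                        (cong (a zero +_) (sumSub+sumSub-∁ (a ∘ suc) B))

sumSub-toggle-∉ : ∀ {n} (a : Fin n → ℕ) {B i} → i ∉ B → sumSub a (toggle B i) ≡ a i + sumSub a B
sumSub-toggle-∉ a {outside ∷ B} {zero}  i∉B = refl
sumSub-toggle-∉ a {inside ∷ B}  {zero}  i∉B = contradiction here i∉B
sumSub-toggle-∉ a {outside ∷ B} {suc i} i∉B = sumSub-toggle-∉ (a ∘ suc) (i∉B ∘ there)
sumSub-toggle-∉ a {inside ∷ B}  {suc i} i∉B =
  trans (cong (a zero +_) (sumSub-toggle-∉ (a ∘ suc) (i∉B ∘ there))) (x∙yz≈y∙xz (a zero) (a (suc i)) _)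

sumSub-toggle-∈ : ∀ {n} (a : Fin n → ℕ) {B i} → i ∈ B → sumSub a B ≡ a i + sumSub a (toggle B i)
sumSub-toggle-∈ a {B} {i} i∈B = begin
  sumSub a B                         ≡⟨ cong (sumSub a) (toggle-involutive B i) ⟨
  sumSub a (toggle (toggle B i) i)   ≡⟨ sumSub-toggle-∉ a (∈⇒∉-toggle i∈B) ⟩
  a i + sumSub a (toggle B i)        ∎
  where open ≡-Reasoning

sumSub≤sumAll : ∀ {n} (a : Fin n → ℕ) B → sumSub a B ≤ sumAll a
sumSub≤sumAll a B = subst (sumSub a B ≤_) (sumSub+sumSub-∁ a B) (m≤m+n _ _)

∈⇒≤sumSub : ∀ {n} (a : Fin n → ℕ) {B i} → i ∈ B → a i ≤ sumSub a B
∈⇒≤sumSub a {B} {i} i∈B = subst (a i ≤_) (sym (sumSub-toggle-∈ a i∈B)) (m≤m+n _ _)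

sumSub>0⇒Nonempty : ∀ {n} (a : Fin n → ℕ) B → 0 < sumSub a B → Nonempty B
sumSub>0⇒Nonempty a (inside ∷ B)  _ = zero , here
sumSub>0⇒Nonempty a (outside ∷ B) p with sumSub>0⇒Nonempty (a ∘ suc) B p
... | i , i∈B = suc i , there i∈B

sumSub-hits-interval : ∀ {n} (a : Fin n → ℕ) {L w} → (∀ i → a i ≤ L) → 0 < w → w ≤ sumAll a →
                       ∃ λ B → w ≤ sumSub a B × sumSub a B < w + L
sumSub-hits-interval {zero} a _ 0<w w≤0 = contradiction w≤0 (<⇒≱ 0<w)
sumSub-hits-interval {suc n} a {L} {w} a≤L 0<w w≤S with w ≤? a zero
... | yes w≤a₀ = ⁅ zero ⁆ , subst (w ≤_) (sym sum₀) w≤a₀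
                          , subst (_< w + L) (sym sum₀) (≤-<-trans (a≤L zero) (m<n+m L 0<w))
  where sum₀ = sumSub-⁅⁆ a zero
... | no w≰a₀ = inside ∷ B , w≤ , <w+L
  where
  a₀<w = ≰⇒> w≰a₀
  w′   = w ∸ a zero
  a₀+w′≡w : a zero + w′ ≡ w
  a₀+w′≡w = m+[n∸m]≡n (<⇒≤ a₀<w)
  rest = sumSub-hits-interval (a ∘ suc) (a≤L ∘ suc) (m<n⇒0<n∸m a₀<w)
           (+-cancelˡ-≤ (a zero) w′ _ (subst (_≤ sumAll a) (sym a₀+w′≡w) w≤S))
  B = proj₁ rest
  w≤ : w ≤ a zero + sumSub (a ∘ suc) B
  w≤ = subst (_≤ a zero + sumSub (a ∘ suc) B) a₀+w′≡w (+-monoʳ-≤ (a zero) (proj₁ (proj₂ rest)))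
  <w+L : a zero + sumSub (a ∘ suc) B < w + L
  <w+L = subst (a zero + sumSub (a ∘ suc) B <_) (trans (sym (+-assoc (a zero) w′ L)) (cong (_+ L) a₀+w′≡w))
           (+-monoʳ-< (a zero) (proj₂ (proj₂ rest)))

-- Summing over all subsets

Σ-subsets : ∀ n → (Subset n → ℕ) → ℕ
Σ-subsets zero    f = f []
Σ-subsets (suc n) f = Σ-subsets n (f ∘ (inside ∷_)) + Σ-subsets n (f ∘ (outside ∷_))

Σ-subsets-cong : ∀ n {f g : Subset n → ℕ} → (∀ B → f B ≡ g B) → Σ-subsets n f ≡ Σ-subsets n g
Σ-subsets-cong zero    f≗g = f≗g []
Σ-subsets-cong (suc n) f≗g = cong₂ _+_ (Σ-subsets-cong n (f≗g ∘ (inside ∷_))) (Σ-subsets-cong n (f≗g ∘ (outside ∷_)))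

Σ-subsets-+ : ∀ n (f g : Subset n → ℕ) → Σ-subsets n (λ B → f B + g B) ≡ Σ-subsets n f + Σ-subsets n g
Σ-subsets-+ zero    f g = refl
Σ-subsets-+ (suc n) f g = trans
  (cong₂ _+_ (Σ-subsets-+ n (f ∘ (inside ∷_)) (g ∘ (inside ∷_))) (Σ-subsets-+ n (f ∘ (outside ∷_)) (g ∘ (outside ∷_))))
  (interchange (Σ-subsets n (f ∘ (inside ∷_))) _ _ _)

Σ-subsets-const : ∀ n c → Σ-subsets n (λ _ → c) ≡ 2 ^ n * c
Σ-subsets-const zero    c = sym (+-identityʳ c)
Σ-subsets-const (suc n) c = trans (cong₂ _+_ (Σ-subsets-const n c) (Σ-subsets-const n c)) (double (2 ^ n) c)
  where
  double : ∀ x c → x * c + x * c ≡ 2 * x * c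
  double = solve-∀

Σ-subsets-∁ : ∀ n (f : Subset n → ℕ) → Σ-subsets n (f ∘ ∁) ≡ Σ-subsets n f
Σ-subsets-∁ zero    f = refl
Σ-subsets-∁ (suc n) f = trans (cong₂ _+_ (Σ-subsets-∁ n (f ∘ (outside ∷_))) (Σ-subsets-∁ n (f ∘ (inside ∷_))))
                              (+-comm (Σ-subsets n (f ∘ (outside ∷_))) _)

Σ-subsets-toggle : ∀ n (f : Subset n → ℕ) i → Σ-subsets n (λ B → f (toggle B i)) ≡ Σ-subsets n f
Σ-subsets-toggle (suc n) f zero    = +-comm (Σ-subsets n (f ∘ (outside ∷_))) _
Σ-subsets-toggle (suc n) f (suc i) = cong₂ _+_ (Σ-subsets-toggle n (f ∘ (inside ∷_)) i) (Σ-subsets-toggle n (f ∘ (outside ∷_)) i)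

Σ-subsets-mono : ∀ n {f g : Subset n → ℕ} → (∀ B → f B ≤ g B) → Σ-subsets n f ≤ Σ-subsets n g
Σ-subsets-mono zero    f≤g = f≤g []
Σ-subsets-mono (suc n) f≤g = +-mono-≤ (Σ-subsets-mono n (f≤g ∘ (inside ∷_))) (Σ-subsets-mono n (f≤g ∘ (outside ∷_)))

+-≤-equality : ∀ {x y z w} → x ≤ z → y ≤ w → x + y ≡ z + w → x ≡ z × y ≡ w
+-≤-equality {x} {y} {z} {w} x≤z y≤w eq = x≡z , +-cancelˡ-≡ x y w (trans eq (cong (_+ w) (sym x≡z)))
  where
  x≡z = ≤-antisym x≤z (+-cancelʳ-≤ w z x (subst (_≤ x + w) eq (+-monoʳ-≤ x y≤w)))

Σ-subsets-≤-equality : ∀ n {f g : Subset n → ℕ} → (∀ B → f B ≤ g B) → Σ-subsets n f ≡ Σ-subsets n g →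
                       ∀ B → f B ≡ g B
Σ-subsets-≤-equality zero    f≤g eq [] = eq
Σ-subsets-≤-equality (suc n) f≤g eq (b ∷ B)
  with +-≤-equality (Σ-subsets-mono n (f≤g ∘ (inside ∷_))) (Σ-subsets-mono n (f≤g ∘ (outside ∷_))) eq
Σ-subsets-≤-equality (suc n) f≤g eq (inside ∷ B)  | eq₁ , _ = Σ-subsets-≤-equality n (f≤g ∘ (inside ∷_)) eq₁ B
Σ-subsets-≤-equality (suc n) f≤g eq (outside ∷ B) | _ , eq₂ = Σ-subsets-≤-equality n (f≤g ∘ (outside ∷_)) eq₂ B

isDivisor? : ∀ {n} (a : Fin n → ℕ) → Decidable (IsDivisor a)
isDivisor? a B = sumSub a B ∣? sumAll a

indicator : ∀ {A : Set} {P : Pred A 0ℓ} → Decidable P → A → ℕ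
indicator P? x = if does (P? x) then 1 else 0

length-filter-map : ∀ {A B : Set} {P : Pred B 0ℓ} (P? : Decidable P) (g : A → B) xs →
                    length (filter P? (map g xs)) ≡ length (filter (P? ∘ g) xs)
length-filter-map P? g []       = refl
length-filter-map P? g (x ∷ xs) with does (P? (g x))
... | true  = cong suc (length-filter-map P? g xs)
... | false = length-filter-map P? g xs

length-filter-allSubsets : ∀ n {P : Pred (Subset n) 0ℓ} (P? : Decidable P) →
                           length (filter P? (allSubsets n)) ≡ Σ-subsets n (indicator P?)
length-filter-allSubsets zero    P? with does (P? [])
... | true  = refl
... | false = refl
length-filter-allSubsets (suc n) P? = begin
  length (filter P? (ins ++ outs))                      ≡⟨ cong length (filter-++ P? ins outs) ⟩
  length (filter P? ins ++ filter P? outs)              ≡⟨ length-++ (filter P? ins) ⟩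
  length (filter P? ins) + length (filter P? outs)      ≡⟨ cong₂ _+_ (count inside) (count outside) ⟩
  Σ-subsets (suc n) (indicator P?)                      ∎
  where
  open ≡-Reasoning
  ins  = map (inside ∷_) (allSubsets n)
  outs = map (outside ∷_) (allSubsets n)
  count : ∀ b → length (filter P? (map (b ∷_) (allSubsets n))) ≡ Σ-subsets n (indicator P? ∘ (b ∷_))
  count b = trans (length-filter-map P? (b ∷_) (allSubsets n)) (length-filter-allSubsets n (P? ∘ (b ∷_)))

indicator-cong : ∀ {A : Set} {P Q : Pred A 0ℓ} (P? : Decidable P) (Q? : Decidable Q) → (∀ x → P x ⇔ Q x) →
                 ∀ x → indicator P? x ≡ indicator Q? x
indicator-cong P? Q? P⇔Q x with P? x | Q? x
... | yes _  | yes _  = refl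
... | no  _  | no  _  = refl
... | yes px | no ¬qx = contradiction (Equivalence.to (P⇔Q x) px) ¬qx
... | no ¬px | yes qx = contradiction (Equivalence.from (P⇔Q x) qx) ¬px

-- Divisors of S and linear arithmetic

∣⇒≮multiples : ∀ {d S} k → d ∣ S → k * d < S → S < suc k * d → Empty
∣⇒≮multiples {d} k (divides q refl) kd<qd qd<[1+k]d =
  <⇒≱ (*-cancelʳ-< d k q kd<qd) (s≤s⁻¹ (*-cancelʳ-< d q (suc k) qd<[1+k]d))

∣⇒>0 : ∀ {d S} → 0 < S → d ∣ S → 0 < d
∣⇒>0 {zero}  0<S 0∣S = contradiction (0∣⇒≡0 0∣S) (≢-sym (<⇒≢ 0<S))
∣⇒>0 {suc d} _   _   = z<s

¬∣-between-half-and-whole : ∀ {d S} → S < 2 * d → d < S → ¬ d ∣ S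
¬∣-between-half-and-whole {d} S<2d d<S d∣S =
  ∣⇒≮multiples 1 d∣S (subst (_< _) (sym (*-identityˡ d)) d<S) S<2d

¬∣-middle-third : ∀ {y S} → S < 3 * y → 3 * y < 2 * S → 2 * y ≢ S → ¬ y ∣ S
¬∣-middle-third {y} {S} S<3y 3y<2S 2y≢S y∣S with <-cmp (2 * y) S
... | tri< 2y<S _ _ = ∣⇒≮multiples 2 y∣S 2y<S S<3y
... | tri≈ _ 2y≡S _ = 2y≢S 2y≡S
... | tri> _ _ S<2y = ¬∣-between-half-and-whole S<2y y<S y∣S
  where
  y<S : y < S
  y<S = ≰⇒> λ S≤y → <⇒≱ 3y<2S (≤-trans (*-monoˡ-≤ S (n≤1+n 2)) (*-monoʳ-≤ 3 S≤y))

∣-between-quarter-and-half : ∀ {d S} → d ∣ S → S < 4 * d → 2 * d < S → 3 * d ≡ S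
∣-between-quarter-and-half {d} {S} d∣S S<4d 2d<S with <-cmp (3 * d) S
... | tri< 3d<S _ _ = ⊥-elim (∣⇒≮multiples 3 d∣S 3d<S S<4d)
... | tri≈ _ 3d≡S _ = 3d≡S
... | tri> _ _ S<3d = ⊥-elim (∣⇒≮multiples 2 d∣S 2d<S S<3d)

∣-between-quarter-and-third : ∀ {d S} → d ∣ S → S ≤ 4 * d → 3 * d < S → 4 * d ≡ S
∣-between-quarter-and-third d∣S S≤4d 3d<S with m≤n⇒m<n∨m≡n S≤4d
... | inj₁ S<4d = ⊥-elim (∣⇒≮multiples 3 d∣S 3d<S S<4d)
... | inj₂ S≡4d = sym S≡4d

module Complementary {s s′ S : ℕ} (s+s′≡S : s + s′ ≡ S) where

  private
    scaled : ∀ k → k * s + k * s′ ≡ k * S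
    scaled k = trans (sym (*-distribˡ-+ k s s′)) (cong (k *_) s+s′≡S)

  half⇒half : 2 * s ≡ S → 2 * s′ ≡ S
  half⇒half 2s≡S = +-cancelˡ-≡ S (2 * s′) S (begin
    S + 2 * s′       ≡⟨ cong (_+ 2 * s′) 2s≡S ⟨
    2 * s + 2 * s′   ≡⟨ scaled 2 ⟩
    2 * S            ≡⟨ cong (S +_) (+-identityʳ S) ⟩
    S + S            ∎)
    where open ≡-Reasoning

  half⇐half : 2 * s′ ≡ S → 2 * s ≡ S
  half⇐half 2s′≡S = +-cancelʳ-≡ (2 * s′) (2 * s) S (begin
    2 * s + 2 * s′   ≡⟨ scaled 2 ⟩
    2 * S            ≡⟨ cong (S +_) (+-identityʳ S) ⟩
    S + S            ≡⟨ cong (S +_) 2s′≡S ⟨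
    S + 2 * s′       ∎)
    where open ≡-Reasoning

  <half⇒>half : 2 * s < S → S < 2 * s′
  <half⇒>half 2s<S = +-cancelˡ-< S S (2 * s′) (begin-strict
    S + S            ≡⟨ cong (S +_) (+-identityʳ S) ⟨
    2 * S            ≡⟨ scaled 2 ⟨
    2 * s + 2 * s′   <⟨ +-monoˡ-< (2 * s′) 2s<S ⟩
    S + 2 * s′       ∎)
    where open ≤-Reasoning

  >third⇒<two-thirds : S < 3 * s → 3 * s′ < 2 * S
  >third⇒<two-thirds S<3s = +-cancelˡ-< S (3 * s′) (2 * S) (begin-strict
    S + 3 * s′       <⟨ +-monoˡ-< (3 * s′) S<3s ⟩
    3 * s + 3 * s′   ≡⟨ scaled 3 ⟩
    3 * S            ≡⟨⟩
    S + 2 * S        ∎)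
    where open ≤-Reasoning

  <two-thirds⇒>third : 3 * s < 2 * S → S < 3 * s′
  <two-thirds⇒>third 3s<2S = +-cancelˡ-< (2 * S) S (3 * s′) (begin-strict
    2 * S + S        ≡⟨ +-comm (2 * S) S ⟩
    3 * S            ≡⟨ scaled 3 ⟨
    3 * s + 3 * s′   <⟨ +-monoˡ-< (3 * s′) 3s<2S ⟩
    2 * S + 3 * s′   ∎)
    where open ≤-Reasoning

shifted-half : ∀ {h c x y S} → 2 * h ≡ S → x ≡ c + h → x + y ≡ S → 0 < c → 2 * c < S →
               S < 2 * x × x < S × 2 * (y + c) ≡ S
shifted-half {h} {c} {_} {y} refl refl x+y≡S 0<c 2c<2h = S<2x , x<S , cong (2 *_) y+c≡h
  where
  S<2x : 2 * h < 2 * (c + h)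
  S<2x = *-monoʳ-< 2 (m<n+m h 0<c)
  x<S : c + h < 2 * h
  x<S = subst (c + h <_) (cong (h +_) (sym (+-identityʳ h))) (+-monoˡ-< h (*-cancelˡ-< 2 c h 2c<2h))
  y+c≡h : y + c ≡ h
  y+c≡h = +-cancelʳ-≡ h (y + c) h (begin
    y + c + h      ≡⟨ xy∙z≈yz∙x y c h ⟩
    c + h + y      ≡⟨ x+y≡S ⟩
    2 * h          ≡⟨ cong (h +_) (+-identityʳ h) ⟩
    h + h          ∎)
    where open ≡-Reasoning

<-by : ∀ {x y l r} → x < y → l + y ≡ r + x → l < r
<-by {x} {y} {l} {r} x<y eq = +-cancelʳ-< y l r (subst (_< r + y) (sym eq) (+-monoʳ-< r x<y))

≤-by : ∀ {x y l r} → x ≤ y → l + y ≡ r + x → l ≤ r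
≤-by {x} {y} {l} {r} x≤y eq = +-cancelʳ-≤ y l r (subst (_≤ r + y) (sym eq) (+-monoʳ-≤ r x≤y))

shifted-quarter : ∀ {h c x S} → 2 * h ≡ S → h ≡ c + x → 0 < c → 4 * c < S → 2 * x < S × S < 4 * x
shifted-quarter {_} {c} {x} refl refl 0<c 4c<S =
  *-monoʳ-< 2 (m<n+m x 0<c) , <-by 4c<S (identity c x)
  where
  identity : ∀ c x → 2 * (c + x) + 2 * (c + x) ≡ 4 * x + 4 * c
  identity = solve-∀

shifted-third : ∀ {c x S} → 3 * x ≡ S → 0 < c → 3 * c < S → S < 3 * (c + x) × 3 * (c + x) < 2 * S
shifted-third {c} {x} refl 0<c 3c<S = *-monoʳ-< 3 (m<n+m x 0<c) , <-by 3c<S (identity c x)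
  where
  identity : ∀ c x → 3 * (c + x) + 3 * x ≡ 2 * (3 * x) + 3 * c
  identity = solve-∀

third∧shifted-half⇒sixth : ∀ {c x S} → 3 * x ≡ S → 2 * (c + x) ≡ S → 6 * c ≡ S
third∧shifted-half⇒sixth {c} {x} refl 2[c+x]≡3x = +-cancelʳ-≡ (6 * x) (6 * c) (3 * x) (begin
  6 * c + 6 * x         ≡⟨ identity₁ c x ⟩
  3 * (2 * (c + x))     ≡⟨ cong (3 *_) 2[c+x]≡3x ⟩
  3 * (3 * x)           ≡⟨ identity₂ x ⟩
  3 * x + 6 * x         ∎)
  where
  open ≡-Reasoning
  identity₁ : ∀ c x → 6 * c + 6 * x ≡ 3 * (2 * (c + x))
  identity₁ = solve-∀
  identity₂ : ∀ x → 3 * (3 * x) ≡ 3 * x + 6 * x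
  identity₂ = solve-∀

∣∧shifted-half⇒sixth : ∀ {d x S} → d ∣ S → 2 * (d + x) ≡ S → 0 < x → 4 * x < S → 6 * x ≡ S
∣∧shifted-half⇒sixth {d} {x} d∣S refl 0<x 4x<S = third∧shifted-half⇒sixth {x} {d} 3d≡S (cong (2 *_) (+-comm x d))
  where
  identity : ∀ d x → 2 * (d + x) + 2 * (d + x) ≡ 4 * d + 4 * x
  identity = solve-∀
  3d≡S = ∣-between-quarter-and-half d∣S (<-by 4x<S (identity d x)) (*-monoʳ-< 2 (m<m+n d 0<x))

quarters⇒≡ : ∀ {p q S} → S ≤ 4 * p → S ≤ 4 * q → 2 * (p + q) ≤ S → p ≡ q
quarters⇒≡ {p} {q} {S} S≤4p S≤4q 2[p+q]≤S = *-cancelˡ-≡ p q 4 (trans (4x≡S {p} {q} S≤4p S≤4q 2[p+q]≤S)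
  (sym (4x≡S {q} {p} S≤4q S≤4p (subst (λ k → 2 * k ≤ S) (+-comm p q) 2[p+q]≤S))))
  where
  identity : ∀ x y S → 4 * x + (2 * S + 4 * y) ≡ S + (2 * (2 * (x + y)) + S)
  identity = solve-∀
  4x≡S : ∀ {x y} → S ≤ 4 * x → S ≤ 4 * y → 2 * (x + y) ≤ S → 4 * x ≡ S
  4x≡S {x} {y} S≤4x S≤4y 2[x+y]≤S =
    ≤-antisym (≤-by (+-mono-≤ (*-monoʳ-≤ 2 2[x+y]≤S) S≤4y) (identity x y S)) S≤4x

too-heavy : ∀ x y z w {S} → S ≤ 6 * x → x < y → S ≤ 4 * z → 2 * w ≡ S → ¬ x + (y + (z + w)) ≤ S
too-heavy x y z w {S} S≤6x x<y S≤4z 2w≡S sum≤S = <⇒≱ (begin-strict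
  12 * S                                                      ≤⟨ *-monoˡ-≤ S (n≤1+n 12) ⟩
  13 * S                                                      ≡⟨ identity₁ S ⟩
  2 * S + (2 * S + (3 * S + 6 * S))                           <⟨ +-mono-≤-< (*-monoʳ-≤ 2 S≤6x) (+-mono-<-≤
                                                                   (*-monoʳ-< 2 (≤-<-trans S≤6x (*-monoʳ-< 6 x<y)))
                                                                   (+-mono-≤ (*-monoʳ-≤ 3 S≤4z) (≤-reflexive (cong (6 *_) (sym 2w≡S))))) ⟩
  2 * (6 * x) + (2 * (6 * y) + (3 * (4 * z) + 6 * (2 * w)))   ≡⟨ identity₂ x y z w ⟩
  12 * (x + (y + (z + w)))                                    ∎) (*-monoʳ-≤ 12 sum≤S)
  where
  open ≤-Reasoning
  identity₁ : ∀ S → 13 * S ≡ 2 * S + (2 * S + (3 * S + 6 * S))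
  identity₁ = solve-∀
  identity₂ : ∀ x y z w → 2 * (6 * x) + (2 * (6 * y) + (3 * (4 * z) + 6 * (2 * w))) ≡ 12 * (x + (y + (z + w)))
  identity₂ = solve-∀

QuarterOrSixth : ℕ → ℕ → Set
QuarterOrSixth S x = S ≤ 4 * x ⊎ 6 * x ≡ S

QuarterOrSixth⇒≥sixth : ∀ {x S} → QuarterOrSixth S x → S ≤ 6 * x
QuarterOrSixth⇒≥sixth {x} (inj₁ S≤4x) = ≤-trans S≤4x (*-monoˡ-≤ x (m≤m+n 4 2))
QuarterOrSixth⇒≥sixth (inj₂ 6x≡S) = ≤-reflexive (sym 6x≡S)

QuarterOrSixth⇒≥quarter : ∀ {x y S} → S ≤ 6 * x → x < y → QuarterOrSixth S y → S ≤ 4 * y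
QuarterOrSixth⇒≥quarter S≤6x x<y (inj₁ S≤4y) = S≤4y
QuarterOrSixth⇒≥quarter S≤6x x<y (inj₂ 6y≡S) = contradiction (≤-<-trans S≤6x (*-monoʳ-< 6 x<y)) (<-irrefl (sym 6y≡S))

-- When 2(d + x) = S, d and x are reflections of each other about S/4.

mirror-below : ∀ {d x S} p q r → r + q ≡ p → 2 * (d + x) ≡ S → 2 * p * x < q * S → r * S < 2 * p * d
mirror-below {d} {x} p q r refl refl 2px<qS = <-by 2px<qS (identity r q d x)
  where
  identity : ∀ r q d x → r * (2 * (d + x)) + q * (2 * (d + x)) ≡ 2 * (r + q) * d + 2 * (r + q) * x
  identity = solve-∀

mirror-above-sixth : ∀ {d x S} → 2 * (d + x) ≡ S → S < 6 * x → 3 * d < S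
mirror-above-sixth {d} {x} refl S<6x = *-cancelˡ-< 2 (3 * d) _ (<-by S<6x (identity d x))
  where
  identity : ∀ d x → 2 * (3 * d) + 6 * x ≡ 2 * (2 * (d + x)) + 2 * (d + x)
  identity = solve-∀

mirror-above-quarter : ∀ {d x S} → 2 * (d + x) ≡ S → S < 4 * x → 4 * d < S
mirror-above-quarter {d} {x} refl S<4x = <-by S<4x (identity d x)
  where
  identity : ∀ d x → 4 * d + 4 * x ≡ 2 * (d + x) + 2 * (d + x)
  identity = solve-∀

rest-of-sixth : ∀ {x r S} → 6 * x ≡ S → x + r ≡ S → 6 * r ≡ 5 * S
rest-of-sixth {x} {r} {S} 6x≡S x+r≡S = +-cancelˡ-≡ S (6 * r) (5 * S) (begin
  S + 6 * r        ≡⟨ cong (_+ 6 * r) 6x≡S ⟨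
  6 * x + 6 * r    ≡⟨ *-distribˡ-+ 6 x r ⟨
  6 * (x + r)      ≡⟨ cong (6 *_) x+r≡S ⟩
  6 * S            ≡⟨⟩
  S + 5 * S        ∎)
  where open ≡-Reasoning

rest-of-sixth-and-quarter : ∀ {x y r S} → 6 * x ≡ S → 4 * y ≡ S → x + (y + r) ≡ S → 12 * r ≡ 7 * S
rest-of-sixth-and-quarter {x} {y} {r} {S} 6x≡S 4y≡S sum≡S = +-cancelˡ-≡ (5 * S) (12 * r) (7 * S) (begin
  5 * S + 12 * r                        ≡⟨ cong (_+ 12 * r) (*-distribʳ-+ S 2 3) ⟩
  2 * S + 3 * S + 12 * r                ≡⟨ cong₂ (λ p q → 2 * p + 3 * q + 12 * r) 6x≡S 4y≡S ⟨
  2 * (6 * x) + 3 * (4 * y) + 12 * r    ≡⟨ identity x y r ⟩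
  12 * (x + (y + r))                    ≡⟨ cong (12 *_) sum≡S ⟩
  12 * S                                ≡⟨ *-distribʳ-+ S 5 7 ⟩
  5 * S + 7 * S                         ∎)
  where
  open ≡-Reasoning
  identity : ∀ x y r → 2 * (6 * x) + 3 * (4 * y) + 12 * r ≡ 12 * (x + (y + r))
  identity = solve-∀

mirror-quarter : ∀ {d x S} → 2 * (d + x) ≡ S → 4 * d ≡ S → 4 * x ≡ S
mirror-quarter {d} {x} refl 4d≡S = +-cancelˡ-≡ (4 * d) (4 * x) (2 * (d + x)) (begin
  4 * d + 4 * x             ≡⟨ identity d x ⟩
  2 * (d + x) + 2 * (d + x) ≡⟨ cong (_+ 2 * (d + x)) 4d≡S ⟨
  4 * d + 2 * (d + x)       ∎)
  where
  open ≡-Reasoning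
  identity : ∀ d x → 4 * d + 4 * x ≡ 2 * (d + x) + 2 * (d + x)
  identity = solve-∀

two-quarters-too-heavy : ∀ x y z w {S} → 0 < x → S ≤ 4 * y → S ≤ 4 * z → 2 * w ≡ S → ¬ x + (y + (z + w)) ≤ S
two-quarters-too-heavy x y z w {S} 0<x S≤4y S≤4z 2w≡S sum≤S = <⇒≱ (begin-strict
  4 * S                                   ≡⟨ identity₁ S ⟩
  S + (S + 2 * S)                         <⟨ +-mono-<-≤ (m<n+m S (*-monoʳ-< 4 0<x))
                                                          (+-mono-≤ S≤4z (≤-reflexive (cong (2 *_) (sym 2w≡S)))) ⟩
  4 * x + S + (4 * z + 2 * (2 * w))       ≤⟨ +-monoˡ-≤ _ (+-monoʳ-≤ (4 * x) S≤4y) ⟩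
  4 * x + 4 * y + (4 * z + 2 * (2 * w))   ≡⟨ identity₂ x y z w ⟩
  4 * (x + (y + (z + w)))                 ∎) (*-monoʳ-≤ 4 sum≤S)
  where
  open ≤-Reasoning
  identity₁ : ∀ S → 4 * S ≡ S + (S + 2 * S)
  identity₁ = solve-∀
  identity₂ : ∀ x y z w → 4 * x + 4 * y + (4 * z + 2 * (2 * w)) ≡ 4 * (x + (y + (z + w)))
  identity₂ = solve-∀

third-of-rest : ∀ {x y z w S} → 6 * y ≡ S → 2 * w ≡ S → x + (y + (z + w)) ≡ S → 3 * (x + z) ≡ S
third-of-rest {x} {y} {z} {w} {S} 6y≡S 2w≡S sum≡S = *-cancelˡ-≡ (3 * (x + z)) S 2 (+-cancelʳ-≡ (4 * S) _ _ (begin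
  2 * (3 * (x + z)) + 4 * S               ≡⟨ cong (2 * (3 * (x + z)) +_) (*-distribʳ-+ S 1 3) ⟩
  2 * (3 * (x + z)) + (1 * S + 3 * S)     ≡⟨ cong (λ p → 2 * (3 * (x + z)) + (1 * S + 3 * p)) 2w≡S ⟨
  2 * (3 * (x + z)) + (1 * S + 3 * (2 * w)) ≡⟨ cong (λ p → 2 * (3 * (x + z)) + (p + 3 * (2 * w))) (trans (*-identityˡ S) (sym 6y≡S)) ⟩
  2 * (3 * (x + z)) + (6 * y + 3 * (2 * w)) ≡⟨ identity x y z w ⟩
  6 * (x + (y + (z + w)))                 ≡⟨ cong (6 *_) sum≡S ⟩
  6 * S                                   ≡⟨ *-distribʳ-+ S 2 4 ⟩
  2 * S + 4 * S                           ∎))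
  where
  open ≡-Reasoning
  identity : ∀ x y z w → 2 * (3 * (x + z)) + (6 * y + 3 * (2 * w)) ≡ 6 * (x + (y + (z + w)))
  identity = solve-∀

multiples-of-smallest : ∀ {x y z w S} → 6 * y ≡ S → 4 * z ≡ S → 2 * w ≡ S → x + (y + (z + w)) ≡ S →
                        y ≡ 2 * x × z ≡ 3 * x × w ≡ 6 * x
multiples-of-smallest {x} {y} {z} {w} {S} 6y≡S 4z≡S 2w≡S sum≡S =
  multiple 6 y 2 6y≡S refl , multiple 4 z 3 4z≡S refl , multiple 2 w 6 2w≡S refl
  where
  open ≡-Reasoning
  identity : ∀ x y z w → 12 * x + (2 * (6 * y) + (3 * (4 * z) + 6 * (2 * w))) ≡ 12 * (x + (y + (z + w)))
  identity = solve-∀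
  12x≡S : 12 * x ≡ S
  12x≡S = +-cancelʳ-≡ (11 * S) (12 * x) S (begin
    12 * x + 11 * S                                          ≡⟨ cong (12 * x +_) (*-distribʳ-+ S 2 9) ⟩
    12 * x + (2 * S + 9 * S)                                 ≡⟨ cong (12 * x +_) (cong (2 * S +_) (*-distribʳ-+ S 3 6)) ⟩
    12 * x + (2 * S + (3 * S + 6 * S))                       ≡⟨ cong (λ p → 12 * x + (2 * p + (3 * S + 6 * S))) 6y≡S ⟨
    12 * x + (2 * (6 * y) + (3 * S + 6 * S))                 ≡⟨ cong (λ p → 12 * x + (2 * (6 * y) + (3 * p + 6 * S))) 4z≡S ⟨
    12 * x + (2 * (6 * y) + (3 * (4 * z) + 6 * S))           ≡⟨ cong (λ p → 12 * x + (2 * (6 * y) + (3 * (4 * z) + 6 * p))) 2w≡S ⟨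
    12 * x + (2 * (6 * y) + (3 * (4 * z) + 6 * (2 * w)))     ≡⟨ identity x y z w ⟩
    12 * (x + (y + (z + w)))                                 ≡⟨ cong (12 *_) sum≡S ⟩
    S + 11 * S                                               ∎)
  multiple : ∀ k v j .{{_ : NonZero k}} → k * v ≡ S → k * j ≡ 12 → v ≡ j * x
  multiple k v j kv≡S kj≡12 = *-cancelˡ-≡ v (j * x) k (begin
    k * v          ≡⟨ kv≡S ⟩
    S              ≡⟨ 12x≡S ⟨
    12 * x         ≡⟨ cong (_* x) kj≡12 ⟨
    k * j * x      ≡⟨ *-assoc k j x ⟩
    k * (j * x)    ∎)

-- Divisors in complementary pairs

module PairCount {m} (a : Fin (suc m) → ℕ) (a>0 : ∀ i → 0 < a i) where

  S : ℕ
  S = sumAll a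

  S>0 : 0 < S
  S>0 = ≤-trans (a>0 zero) (m≤m+n (a zero) _)

  χ : Subset (suc m) → ℕ
  χ = indicator (isDivisor? a)

  χ≤1 : ∀ B → χ B ≤ 1
  χ≤1 B with sumSub a B ∣? S
  ... | yes _ = ≤-refl
  ... | no  _ = z≤n

  χ-∣ : ∀ B → sumSub a B ∣ S → χ B ≡ 1
  χ-∣ B ∣S with sumSub a B ∣? S
  ... | yes _  = refl
  ... | no  ∤S = contradiction ∣S ∤S

  χ-∤ : ∀ B → ¬ sumSub a B ∣ S → χ B ≡ 0
  χ-∤ B ∤S with sumSub a B ∣? S
  ... | yes ∣S = contradiction ∣S ∤S
  ... | no  _  = refl

  χ≡1⇒∣ : ∀ B → χ B ≡ 1 → sumSub a B ∣ S
  χ≡1⇒∣ B χ≡1 with sumSub a B ∣? S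
  ... | yes ∣S = ∣S

  pairCount : Subset (suc m) → ℕ
  pairCount B = χ B + χ (∁ B)

  pairCount-∁ : ∀ B → pairCount (∁ B) ≡ pairCount B
  pairCount-∁ B = trans (cong (χ (∁ B) +_) (cong χ (∁-involutive B))) (+-comm (χ (∁ B)) (χ B))

  pairCount≤2 : ∀ B → pairCount B ≤ 2
  pairCount≤2 B = +-mono-≤ (χ≤1 B) (χ≤1 (∁ B))

  Σ-pairCount : Σ-subsets (suc m) pairCount ≡ 2 * numDivisors a
  Σ-pairCount = begin
    Σ-subsets (suc m) pairCount                        ≡⟨ Σ-subsets-+ (suc m) χ (χ ∘ ∁) ⟩
    Σ-subsets (suc m) χ + Σ-subsets (suc m) (χ ∘ ∁)    ≡⟨ cong (Σ-subsets (suc m) χ +_) (Σ-subsets-∁ (suc m) χ) ⟩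
    Σ-subsets (suc m) χ + Σ-subsets (suc m) χ          ≡⟨ cong (λ k → k + k) (length-filter-allSubsets (suc m) _) ⟨
    numDivisors a + numDivisors a                      ≡⟨ cong (numDivisors a +_) (+-identityʳ _) ⟨
    2 * numDivisors a                                  ∎
    where open ≡-Reasoning

  module ComplementOf B = Complementary {sumSub a B} {sumSub a (∁ B)} (sumSub+sumSub-∁ a B)

  sum<S : ∀ B → 0 < sumSub a (∁ B) → sumSub a B < S
  sum<S B p = subst (sumSub a B <_) (sumSub+sumSub-∁ a B) (m<m+n _ p)

  sum-∁<S : ∀ B → 0 < sumSub a B → sumSub a (∁ B) < S
  sum-∁<S B p = subst (sumSub a (∁ B) <_) (sumSub+sumSub-∁ a B) (m<n+m _ p)

  pairCount≡2⇒∣ : ∀ B → pairCount B ≡ 2 → sumSub a B ∣ S × sumSub a (∁ B) ∣ S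
  pairCount≡2⇒∣ B pc≡2 with +-≤-equality (χ≤1 B) (χ≤1 (∁ B)) pc≡2
  ... | χ≡1 , χ′≡1 = χ≡1⇒∣ B χ≡1 , χ≡1⇒∣ (∁ B) χ′≡1

  pairCount≡2⇒half : ∀ B → pairCount B ≡ 2 → 2 * sumSub a B ≡ S
  pairCount≡2⇒half B pc≡2 with pairCount≡2⇒∣ B pc≡2 | <-cmp (2 * sumSub a B) S
  ... | _ , _ | tri≈ _ half _ = half
  ... | ∣S , ∣S′ | tri< 2s<S _ _ =
    ⊥-elim (¬∣-between-half-and-whole (ComplementOf.<half⇒>half B 2s<S) (sum-∁<S B (∣⇒>0 S>0 ∣S)) ∣S′)
  ... | ∣S , ∣S′ | tri> _ _ S<2s = ⊥-elim (¬∣-between-half-and-whole S<2s (sum<S B (∣⇒>0 S>0 ∣S′)) ∣S)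

  pairCount≤1⊎≡2 : ∀ B → pairCount B ≤ 1 ⊎ pairCount B ≡ 2
  pairCount≤1⊎≡2 B with m≤n⇒m<n∨m≡n (pairCount≤2 B)
  ... | inj₁ pc<2 = inj₁ (s≤s⁻¹ pc<2)
  ... | inj₂ pc≡2 = inj₂ pc≡2

  pairCount≤1 : ∀ B → 2 * sumSub a B ≢ S → pairCount B ≤ 1
  pairCount≤1 B ¬half with pairCount≤1⊎≡2 B
  ... | inj₁ pc≤1 = pc≤1
  ... | inj₂ pc≡2 = contradiction (pairCount≡2⇒half B pc≡2) ¬half

  pairCount-∤∤ : ∀ B → ¬ sumSub a B ∣ S → ¬ sumSub a (∁ B) ∣ S → pairCount B ≡ 0
  pairCount-∤∤ B ∤S ∤S′ = cong₂ _+_ (χ-∤ B ∤S) (χ-∤ (∁ B) ∤S′)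

  pairCount-middle-third : ∀ B → S < 3 * sumSub a B → 3 * sumSub a B < 2 * S → 2 * sumSub a B ≢ S → pairCount B ≡ 0
  pairCount-middle-third B S<3s 3s<2S ¬half = pairCount-∤∤ B
    (¬∣-middle-third S<3s 3s<2S ¬half)
    (¬∣-middle-third (ComplementOf.<two-thirds⇒>third B 3s<2S) (ComplementOf.>third⇒<two-thirds B S<3s)
                     (¬half ∘ ComplementOf.half⇐half B))

  -- Toggling u turns the sums S/2, S/2 of a half and its complement into a u + S/2 ∈ (S/2, S) and d = S/2 − a u.
  BreaksHalves : Fin (suc m) → Set
  BreaksHalves u = 2 * a u < S × (∀ d → 2 * (d + a u) ≡ S → ¬ d ∣ S)

  pairCount-toggle-∉-half : ∀ {u B} → BreaksHalves u → u ∉ B → 2 * sumSub a B ≡ S → pairCount (toggle B u) ≡ 0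
  pairCount-toggle-∉-half {u} {B} (2aᵤ<S , ¬∣) u∉B half
    with shifted-half half (sumSub-toggle-∉ a u∉B) (sumSub+sumSub-∁ a (toggle B u)) (a>0 u) 2aᵤ<S
  ... | S<2x , x<S , 2[y+aᵤ]≡S =
    pairCount-∤∤ (toggle B u) (¬∣-between-half-and-whole S<2x x<S) (¬∣ _ 2[y+aᵤ]≡S)

  pairCount-toggle-half : ∀ {u} → BreaksHalves u → ∀ B → 2 * sumSub a B ≡ S → pairCount (toggle B u) ≡ 0
  pairCount-toggle-half {u} breaks B half with u ∈? B
  ... | no u∉B = pairCount-toggle-∉-half breaks u∉B half
  ... | yes u∈B = begin
    pairCount (toggle B u)        ≡⟨ pairCount-∁ (toggle B u) ⟨
    pairCount (∁ (toggle B u))    ≡⟨ cong pairCount (∁-toggle B u) ⟩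
    pairCount (toggle (∁ B) u)    ≡⟨ pairCount-toggle-∉-half breaks (x∈p⇒x∉∁p u∈B) (ComplementOf.half⇒half B half) ⟩
    0                             ∎
    where open ≡-Reasoning

  pairCount+pairCount-toggle≤2 : ∀ {u} → BreaksHalves u → ∀ B → pairCount B + pairCount (toggle B u) ≤ 2
  pairCount+pairCount-toggle≤2 {u} breaks B with pairCount≤1⊎≡2 B | pairCount≤1⊎≡2 (toggle B u)
  ... | inj₂ pc≡2 | _ =
    ≤-reflexive (cong₂ _+_ pc≡2 (pairCount-toggle-half breaks B (pairCount≡2⇒half B pc≡2)))
  ... | inj₁ _ | inj₂ pc′≡2 = ≤-reflexive (cong₂ _+_ pc≡0 pc′≡2)
    where
    pc≡0 : pairCount B ≡ 0
    pc≡0 = trans (cong pairCount (sym (toggle-involutive B u)))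
                 (pairCount-toggle-half breaks (toggle B u) (pairCount≡2⇒half (toggle B u) pc′≡2))
  ... | inj₁ pc≤1 | inj₁ pc′≤1 = +-mono-≤ pc≤1 pc′≤1

  Σ-pairCount≡2^[1+m] : numDivisors a ≡ 2 ^ m → Σ-subsets (suc m) pairCount ≡ 2 ^ suc m
  Σ-pairCount≡2^[1+m] count = trans Σ-pairCount (cong (2 *_) count)

  pairCount≡1⇒count : (∀ B → pairCount B ≡ 1) → numDivisors a ≡ 2 ^ m
  pairCount≡1⇒count pc≡1 = *-cancelˡ-≡ (numDivisors a) (2 ^ m) 2 (begin
    2 * numDivisors a                ≡⟨ Σ-pairCount ⟨
    Σ-subsets (suc m) pairCount      ≡⟨ Σ-subsets-cong (suc m) pc≡1 ⟩
    Σ-subsets (suc m) (λ _ → 1)      ≡⟨ Σ-subsets-const (suc m) 1 ⟩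
    2 ^ suc m * 1                    ≡⟨ *-identityʳ _ ⟩
    2 * 2 ^ m                        ∎)
    where open ≡-Reasoning

  count⇒pairCount≡1 : numDivisors a ≡ 2 ^ m → (∀ B → pairCount B ≤ 1) → ∀ B → pairCount B ≡ 1
  count⇒pairCount≡1 count pc≤1 = Σ-subsets-≤-equality (suc m) pc≤1
    (trans (Σ-pairCount≡2^[1+m] count) (sym (trans (Σ-subsets-const (suc m) 1) (*-identityʳ _))))

  count⇒pairCount+pairCount-toggle≡2 : ∀ {u} → numDivisors a ≡ 2 ^ m → BreaksHalves u →
                                        ∀ B → pairCount B + pairCount (toggle B u) ≡ 2
  count⇒pairCount+pairCount-toggle≡2 {u} count breaks =
    Σ-subsets-≤-equality (suc m) (pairCount+pairCount-toggle≤2 breaks) (begin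
    Σ-subsets (suc m) (λ B → pairCount B + pairCount (toggle B u))
      ≡⟨ Σ-subsets-+ (suc m) pairCount (pairCount ∘ (λ B → toggle B u)) ⟩
    Σ-subsets (suc m) pairCount + Σ-subsets (suc m) (λ B → pairCount (toggle B u))
      ≡⟨ cong (Σ-subsets (suc m) pairCount +_) (Σ-subsets-toggle (suc m) pairCount u) ⟩
    Σ-subsets (suc m) pairCount + Σ-subsets (suc m) pairCount                ≡⟨ cong (λ k → k + k) (Σ-pairCount≡2^[1+m] count) ⟩
    2 ^ suc m + 2 ^ suc m                                                    ≡⟨ cong (2 ^ suc m +_) (+-identityʳ _) ⟨
    2 * 2 ^ suc m                                                            ≡⟨ *-comm 2 (2 ^ suc m) ⟩
    2 ^ suc m * 2                                                            ≡⟨ Σ-subsets-const (suc m) 2 ⟨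
    Σ-subsets (suc m) (λ _ → 2)                                              ∎)
    where open ≡-Reasoning

-- Positive sets and their halves

IsPosSet-tail : ∀ {n} {a : Fin (suc n) → ℕ} → IsPosSet a → IsPosSet (a ∘ suc)
IsPosSet-tail (a>0 , a-mono) = a>0 ∘ suc , λ i j i<j → a-mono (suc i) (suc j) (s≤s i<j)

size*min≤sum : ∀ {n} {a : Fin (suc n) → ℕ} → IsPosSet a → suc n * a zero ≤ sumAll a
size*min≤sum {zero}  {a} _   = ≤-refl
size*min≤sum {suc n} {a} pos = +-monoʳ-≤ (a zero) (≤-trans (*-monoʳ-≤ (suc n) (<⇒≤ (proj₂ pos zero (suc zero) z<s)))
                                                        (size*min≤sum (IsPosSet-tail pos)))

size*min<sum : ∀ {n} {a : Fin (2 + n) → ℕ} → IsPosSet a → (2 + n) * a zero < sumAll a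
size*min<sum {n} {a} pos = +-monoʳ-< (a zero) (<-≤-trans (*-monoʳ-< (suc n) (proj₂ pos zero (suc zero) z<s))
                                                        (size*min≤sum (IsPosSet-tail pos)))

module _ {m} {a : Fin (suc m) → ℕ} (pos : IsPosSet a) where

  IsPosSet-injective : ∀ {i j} → a i ≡ a j → i ≡ j
  IsPosSet-injective {i} {j} aᵢ≡aⱼ with Fin.<-cmp i j
  ... | tri< i<j _ _ = contradiction aᵢ≡aⱼ (<⇒≢ (proj₂ pos i j i<j))
  ... | tri≈ _ i≡j _ = i≡j
  ... | tri> _ _ j<i = contradiction (sym aᵢ≡aⱼ) (<⇒≢ (proj₂ pos j i j<i))

  IsPosSet-≤max : ∀ i → a i ≤ a (fromℕ m)
  IsPosSet-≤max i with Fin.<-cmp i (fromℕ m)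
  ... | tri< i<max _ _ = <⇒≤ (proj₂ pos i (fromℕ m) i<max)
  ... | tri≈ _ i≡max _ = ≤-reflexive (cong a i≡max)
  ... | tri> _ _ max<i = contradiction (Fin.≤fromℕ i) (<⇒≱ max<i)

  private
    S = sumAll a
    N = a (fromℕ m)

    S>0 : 0 < S
    S>0 = ≤-trans (proj₁ pos zero) (m≤m+n (a zero) _)

    InMiddleThird : ℕ → Set
    InMiddleThird y = S < 3 * y × 3 * y < 2 * S

  ∃sumSub-middle-third : ∀ {u} → 3 * a u < S → 2 * N ≤ S → ∃ λ Y → InMiddleThird (sumSub a Y)
  ∃sumSub-middle-third {u} 3aᵤ<S 2N≤S with <-cmp S (3 * N)
  ... | tri< S<3N _ _ = ⁅ fromℕ m ⁆ , subst InMiddleThird (sym (sumSub-⁅⁆ a (fromℕ m))) (S<3N , 3N<2S)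
    where
    3N<2S : 3 * N < 2 * S
    3N<2S = <-≤-trans (*-monoˡ-< N {{>-nonZero (proj₁ pos (fromℕ m))}} (n<1+n 3))
                      (subst (_≤ 2 * S) (sym (*-assoc 2 2 N)) (*-monoʳ-≤ 2 2N≤S))
  ... | tri≈ _ S≡3N _ = toggle ⁅ fromℕ m ⁆ u ,
                        subst InMiddleThird (sym ΣY≡aᵤ+N) (shifted-third (sym S≡3N) (proj₁ pos u) 3aᵤ<S)
    where
    u∉⁅max⁆ : u ∉ ⁅ fromℕ m ⁆
    u∉⁅max⁆ u∈ = <⇒≢ 3aᵤ<S (trans (cong (λ i → 3 * a i) (x∈⁅y⁆⇒x≡y (fromℕ m) u∈)) (sym S≡3N))
    ΣY≡aᵤ+N : sumSub a (toggle ⁅ fromℕ m ⁆ u) ≡ a u + N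
    ΣY≡aᵤ+N = trans (sumSub-toggle-∉ a u∉⁅max⁆) (cong (a u +_) (sumSub-⁅⁆ a (fromℕ m)))
  ... | tri> _ _ 3N<S with sumSub-hits-interval a IsPosSet-≤max (z<s {S / 3}) (m/n<m S 3 {{>-nonZero S>0}} (s≤s (s≤s z≤n)))
  ...   | Y , 1+q≤ΣY , ΣY<1+q+N = Y , <-≤-trans S<3[1+q] (*-monoʳ-≤ 3 1+q≤ΣY) , (begin-strict
    3 * sumSub a Y    ≤⟨ *-monoʳ-≤ 3 (s≤s⁻¹ ΣY<1+q+N) ⟩
    3 * (q + N)       ≡⟨ *-distribˡ-+ 3 q N ⟩
    3 * q + 3 * N     ≤⟨ +-monoˡ-≤ (3 * N) (subst (_≤ S) (*-comm q 3) (m/n*n≤m S 3)) ⟩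
    S + 3 * N         <⟨ +-monoʳ-< S 3N<S ⟩
    S + S             ≡⟨ cong (S +_) (+-identityʳ S) ⟨
    2 * S             ∎)
    where
    open ≤-Reasoning
    q = S / 3
    S<3[1+q] : S < 3 * suc q
    S<3[1+q] = begin-strict
      S              ≡⟨ m≡m%n+[m/n]*n S 3 ⟩
      S % 3 + q * 3  <⟨ +-monoˡ-< (q * 3) (m%n<n S 3) ⟩
      3 + q * 3      ≡⟨ cong (3 +_) (*-comm q 3) ⟩
      3 + 3 * q      ≡⟨ *-suc 3 q ⟨
      3 * suc q      ∎

module MaximalCount {m} {a : Fin (suc m) → ℕ} (pos : IsPosSet a) (count : numDivisors a ≡ 2 ^ m)
  {u} (breaks : PairCount.BreaksHalves a (proj₁ pos) u)
  (3aᵤ<S : 3 * a u < sumAll a) (6aᵤ≢S : 6 * a u ≢ sumAll a) (2N≤S : 2 * a (fromℕ m) ≤ sumAll a) where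

  open PairCount a (proj₁ pos)

  private
    a>0 = proj₁ pos

  pairCount+toggle≡2 : ∀ B → pairCount B + pairCount (toggle B u) ≡ 2
  pairCount+toggle≡2 = count⇒pairCount+pairCount-toggle≡2 count breaks

  half-of-pairCount≡0 : ∀ X → pairCount X ≡ 0 → 2 * sumSub a (toggle X u) ≡ S
  half-of-pairCount≡0 X pc≡0 = pairCount≡2⇒half (toggle X u)
    (trans (cong (_+ pairCount (toggle X u)) (sym pc≡0)) (pairCount+toggle≡2 X))

  half-of-pairCount-toggle≡0 : ∀ X → pairCount (toggle X u) ≡ 0 → 2 * sumSub a X ≡ S
  half-of-pairCount-toggle≡0 X pc≡0 = pairCount≡2⇒half X
    (trans (sym (+-identityʳ _)) (trans (cong (pairCount X +_) (sym pc≡0)) (pairCount+toggle≡2 X)))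

  ∃half : ∃ λ H → 2 * sumSub a H ≡ S
  ∃half with ∃sumSub-middle-third pos 3aᵤ<S 2N≤S
  ... | Y , S<3y , 3y<2S with 2 * sumSub a Y ≟ S
  ...   | yes half = Y , half
  ...   | no ¬half = toggle Y u , half-of-pairCount≡0 Y (pairCount-middle-third Y S<3y 3y<2S ¬half)

  ∃half-∌u : ∃ λ H → 2 * sumSub a H ≡ S × u ∉ H
  ∃half-∌u with ∃half
  ... | H , half with u ∈? H
  ...   | no u∉H  = H , half , u∉H
  ...   | yes u∈H = ∁ H , ComplementOf.half⇒half H half , x∈p⇒x∉∁p u∈H

  module _ {H} (half : 2 * sumSub a H ≡ S) (u∉H : u ∉ H) where

    private
      u≢∈ : ∀ {b} → b ∈ H → u ≢ b
      u≢∈ b∈H u≡b = u∉H (subst (_∈ H) (sym u≡b) b∈H)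

    shifted-by-u-half : ∀ {X} → u ∉ X → 2 * sumSub a X < S → S < 4 * sumSub a X → 2 * (a u + sumSub a X) ≡ S
    shifted-by-u-half {X} u∉X 2x<S S<4x with 3 * sumSub a X ≟ S
    ... | yes 3x≡S = contradiction (half-of-pairCount-toggle≡0 X pc′≡0) (<⇒≢ 2x<S)
      where
      ΣX′ = sumSub-toggle-∉ a u∉X
      pc′≡0 : pairCount (toggle X u) ≡ 0
      pc′≡0 with shifted-third 3x≡S (a>0 u) 3aᵤ<S
      ... | S<3x′ , 3x′<2S = pairCount-middle-third (toggle X u)
        (subst (λ y → S < 3 * y) (sym ΣX′) S<3x′) (subst (λ y → 3 * y < 2 * S) (sym ΣX′) 3x′<2S)
        (λ h → 6aᵤ≢S (third∧shifted-half⇒sixth {a u} 3x≡S (subst (λ y → 2 * y ≡ S) ΣX′ h)))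
    ... | no 3x≢S = subst (λ y → 2 * y ≡ S) (sumSub-toggle-∉ a u∉X) (half-of-pairCount≡0 X (pairCount-∤∤ X
      (λ x∣S → 3x≢S (∣-between-quarter-and-half x∣S S<4x 2x<S))
      (¬∣-between-half-and-whole (ComplementOf.<half⇒>half X 2x<S) (sum-∁<S X x>0))))
      where
      x>0 : 0 < sumSub a X
      x>0 = *-cancelˡ-< 4 0 (sumSub a X) (≤-<-trans z≤n S<4x)

    ∈half⇒S≤4a : ∀ {b} → b ∈ H → S ≤ 4 * a b
    ∈half⇒S≤4a {b} b∈H = ≮⇒≥ λ 4aᵦ<S →
      let X = toggle H b
          ΣH≡aᵦ+ΣX = sumSub-toggle-∈ a b∈H
          2x<S , S<4x = shifted-quarter half ΣH≡aᵦ+ΣX (a>0 b) 4aᵦ<S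
          2[aᵤ+ΣX]≡S = shifted-by-u-half (∉-toggle (u≢∈ b∈H) u∉H) 2x<S S<4x
          2[aᵦ+ΣX]≡S = trans (cong (2 *_) (sym ΣH≡aᵦ+ΣX)) half
      in u≢∈ b∈H (IsPosSet-injective pos (+-cancelʳ-≡ (sumSub a X) (a u) (a b)
           (*-cancelˡ-≡ _ _ 2 (trans 2[aᵤ+ΣX]≡S (sym 2[aᵦ+ΣX]≡S)))))

    ∉half⇒QuarterOrSixth : ∀ {c} → c ≢ u → c ∉ H → QuarterOrSixth S (a c)
    ∉half⇒QuarterOrSixth {c} c≢u c∉H with S ≤? 4 * a c | 6 * a c ≟ S
    ... | yes S≤4ac | _        = inj₁ S≤4ac
    ... | no _      | yes 6ac≡S = inj₂ 6ac≡S
    ... | no S≰4ac  | no 6ac≢S  =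
      let X = toggle H c
          4ac<S = ≰⇒> S≰4ac
          S<2x , x<S , 2[y+ac]≡S = shifted-half half (sumSub-toggle-∉ a c∉H) (sumSub+sumSub-∁ a X) (a>0 c)
                                     (≤-<-trans (*-monoˡ-≤ (a c) (m≤m+n 2 2)) 4ac<S)
          pc≡0 = pairCount-∤∤ X (¬∣-between-half-and-whole S<2x x<S)
                   (λ y∣S → 6ac≢S (∣∧shifted-half⇒sixth y∣S 2[y+ac]≡S (a>0 c) 4ac<S))
          2[aᵤ+x]≡S = subst (λ y → 2 * y ≡ S) (sumSub-toggle-∉ a (∉-toggle (≢-sym c≢u) u∉H)) (half-of-pairCount≡0 X pc≡0)
      in ⊥-elim (<⇒≱ S<2x (subst (2 * sumSub a X ≤_) 2[aᵤ+x]≡S (*-monoʳ-≤ 2 (m≤n+m _ (a u)))))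

    ∃half-element : ∃ λ j → 2 * a j ≡ S
    ∃half-element with sumSub>0⇒Nonempty a H (*-cancelˡ-< 2 0 _ (subst (0 <_) (sym half) S>0))
    ... | b , b∈H with 2 * a b ≟ S
    ...   | yes 2aᵦ≡S = b , 2aᵦ≡S
    ...   | no 2aᵦ≢S =
      let ΣH≡aᵦ+ΣX = sumSub-toggle-∈ a b∈H
          x>0 : 0 < sumSub a (toggle H b)
          x>0 = n≢0⇒n>0 λ x≡0 →
            2aᵦ≢S (trans (cong (2 *_) (sym (trans ΣH≡aᵦ+ΣX (trans (cong (a b +_) x≡0) (+-identityʳ _))))) half)
          b′ , b′∈X = sumSub>0⇒Nonempty a (toggle H b) x>0
          b′≢b : b′ ≢ b
          b′≢b b′≡b = ∈⇒∉-toggle b∈H (subst (_∈ toggle H b) b′≡b b′∈X)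
          b′∈H = ∈-toggle⁻ b′≢b b′∈X
          2[aᵦ+aᵦ′]≤S = subst (2 * (a b + a b′) ≤_) half
                          (*-monoʳ-≤ 2 (subst (a b + a b′ ≤_) (sym ΣH≡aᵦ+ΣX) (+-monoʳ-≤ (a b) (∈⇒≤sumSub a b′∈X))))
      in ⊥-elim (b′≢b (sym (IsPosSet-injective pos (quarters⇒≡ (∈half⇒S≤4a b∈H) (∈half⇒S≤4a b′∈H) 2[aᵦ+aᵦ′]≤S))))

  2N≡S : 2 * a (fromℕ m) ≡ S
  2N≡S with ∃half-∌u
  ... | H , half , u∉H with ∃half-element half u∉H
  ...   | j , 2aⱼ≡S = ≤-antisym 2N≤S (subst (_≤ 2 * a (fromℕ m)) 2aⱼ≡S (*-monoʳ-≤ 2 (IsPosSet-≤max pos j)))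

  QuarterOrSixth-≢u : ∀ i → i ≢ u → QuarterOrSixth S (a i)
  QuarterOrSixth-≢u i i≢u with ∃half-∌u
  ... | H , half , u∉H with i ∈? H
  ...   | yes i∈H = inj₁ (∈half⇒S≤4a half u∉H i∈H)
  ...   | no i∉H  = ∉half⇒QuarterOrSixth half u∉H i≢u i∉H

-- Anti-pencils

module _ {m} {a : Fin (suc m) → ℕ} (pos : IsPosSet a) where

  open PairCount a (proj₁ pos)

  private
    N = a (fromℕ m)

    ∌max⇒pairCount≡1 : AntiPencil a → ∀ B → fromℕ m ∉ B → pairCount B ≡ 1
    ∌max⇒pairCount≡1 antiPencil B max∉B with sumSub a B ≟ 0
    ... | yes ΣB≡0 = cong₂ _+_ (χ-∤ B (λ ∣S → <⇒≢ S>0 (sym (0∣⇒≡0 (subst (_∣ S) ΣB≡0 ∣S)))))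
                               (χ-∣ (∁ B) (subst (_∣ S) (sym Σ∁B≡S) ∣-refl))
      where
      Σ∁B≡S : sumSub a (∁ B) ≡ S
      Σ∁B≡S = trans (cong (_+ sumSub a (∁ B)) (sym ΣB≡0)) (sumSub+sumSub-∁ a B)
    ... | no ΣB≢0 with sumSub>0⇒Nonempty a B (n≢0⇒n>0 ΣB≢0)
    ...   | i , i∈B = cong₂ _+_ (χ-∣ B (Equivalence.from (antiPencil B) (inj₁ ((i , i∈B) , max∉B)))) (χ-∤ (∁ B) ∁B∤S)
      where
      ∁B∤S : ¬ sumSub a (∁ B) ∣ S
      ∁B∤S ∣S with Equivalence.to (antiPencil (∁ B)) ∣S
      ... | inj₁ (_ , max∉∁B) = max∉∁B (x∉p⇒x∈∁p max∉B)
      ... | inj₂ ∁B≡⊤         = ∈⇒∁≢⊤ i∈B ∁B≡⊤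

  AntiPencil⇒pairCount≡1 : AntiPencil a → ∀ B → pairCount B ≡ 1
  AntiPencil⇒pairCount≡1 antiPencil B with fromℕ m ∈? B
  ... | no max∉B  = ∌max⇒pairCount≡1 antiPencil B max∉B
  ... | yes max∈B = trans (sym (pairCount-∁ B)) (∌max⇒pairCount≡1 antiPencil (∁ B) (x∈p⇒x∉∁p max∈B))

  AntiPencil⇒count : AntiPencil a → numDivisors a ≡ 2 ^ m
  AntiPencil⇒count = pairCount≡1⇒count ∘ AntiPencil⇒pairCount≡1

  module _ (S<2N : S < 2 * N) where

    private
      ∋max⇒>half : ∀ {B} → fromℕ m ∈ B → S < 2 * sumSub a B
      ∋max⇒>half max∈B = <-≤-trans S<2N (*-monoʳ-≤ 2 (∈⇒≤sumSub a max∈B))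

      ∋max⇒∤ : ∀ {B} → fromℕ m ∈ B → B ≢ ⊤ → ¬ sumSub a B ∣ S
      ∋max⇒∤ {B} max∈B B≢⊤ with ≢⊤⇒∃∉ B≢⊤
      ... | i , i∉B = ¬∣-between-half-and-whole (∋max⇒>half max∈B)
        (<-≤-trans (m<n+m _ (proj₁ pos i)) (subst (_≤ S) (sumSub-toggle-∉ a i∉B) (sumSub≤sumAll a (toggle B i))))

      ¬half : ∀ B → 2 * sumSub a B ≢ S
      ¬half B half with fromℕ m ∈? B
      ... | yes max∈B = <⇒≢ (∋max⇒>half max∈B) (sym half)
      ... | no max∉B  = <⇒≢ (∋max⇒>half (x∉p⇒x∈∁p max∉B))
                            (sym (ComplementOf.half⇒half B half))

    count⇒AntiPencil : numDivisors a ≡ 2 ^ m → AntiPencil a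
    count⇒AntiPencil count B = mk⇔ to from
      where
      to : IsDivisor a B → (Nonempty B × fromℕ m ∉ B) ⊎ B ≡ ⊤
      to ∣S with ≡-dec _≟ᵇ_ B ⊤
      ... | yes B≡⊤ = inj₂ B≡⊤
      ... | no B≢⊤  = inj₁ (sumSub>0⇒Nonempty a B (∣⇒>0 S>0 ∣S) , λ max∈B → ∋max⇒∤ max∈B B≢⊤ ∣S)
      from : (Nonempty B × fromℕ m ∉ B) ⊎ B ≡ ⊤ → IsDivisor a B
      from (inj₂ refl) = ∣-refl
      from (inj₁ ((i , i∈B) , max∉B)) = χ≡1⇒∣ B (begin
        χ B                  ≡⟨ +-identityʳ (χ B) ⟨
        χ B + 0              ≡⟨ cong (χ B +_) (χ-∤ (∁ B) (∋max⇒∤ (x∉p⇒x∈∁p max∉B) (∈⇒∁≢⊤ i∈B))) ⟨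
        pairCount B          ≡⟨ count⇒pairCount≡1 count (λ B → pairCount≤1 B (¬half B)) B ⟩
        1                    ∎)
        where open ≡-Reasoning

-- Sets whose largest element is at most S/2

small⇒BreaksHalves : ∀ {m} {a : Fin (suc m) → ℕ} (pos : IsPosSet a) {u} →
                     4 * a u < sumAll a → 6 * a u ≢ sumAll a → PairCount.BreaksHalves a (proj₁ pos) u
small⇒BreaksHalves {a = a} pos {u} 4aᵤ<S 6aᵤ≢S =
  ≤-<-trans (*-monoˡ-≤ (a u) (m≤m+n 2 2)) 4aᵤ<S ,
  λ d 2[d+aᵤ]≡S d∣S → 6aᵤ≢S (∣∧shifted-half⇒sixth d∣S 2[d+aᵤ]≡S (proj₁ pos u) 4aᵤ<S)

module SmallestBreaksHalves {k} {a : Fin (4 + k) → ℕ} (pos : IsPosSet a) (count : numDivisors a ≡ 2 ^ (3 + k))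
  (6a₀≢S : 6 * a zero ≢ sumAll a) (2N≤S : 2 * a (fromℕ (3 + k)) ≤ sumAll a) where

  4a₀<S : 4 * a zero < sumAll a
  4a₀<S = ≤-<-trans (*-monoˡ-≤ (a zero) (m≤m+n 4 k)) (size*min<sum pos)

  open MaximalCount pos count (small⇒BreaksHalves pos 4a₀<S 6a₀≢S)
                     (≤-<-trans (*-monoˡ-≤ (a zero) (n≤1+n 3)) 4a₀<S) 6a₀≢S 2N≤S public
    using (pairCount+toggle≡2; 2N≡S; QuarterOrSixth-≢u)

small-top∧¬sixth⇒count≢ : ∀ {k} {a : Fin (5 + k) → ℕ} → IsPosSet a → 2 * a (fromℕ (4 + k)) ≤ sumAll a →
                          6 * a zero ≢ sumAll a → numDivisors a ≢ 2 ^ (4 + k)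
small-top∧¬sixth⇒count≢ {k} {a} pos 2N≤S 6a₀≢S count =
  too-heavy (a i₁) (a i₂) (a i₃) (a (fromℕ (4 + k))) S≤6a₁ a₁<a₂
    (QuarterOrSixth⇒≥quarter S≤6a₁ (<-trans a₁<a₂ a₂<a₃) (QuarterOrSixth-≢u i₃ λ ())) 2N≡S
    (subst (λ w → a i₁ + (a i₂ + (a i₃ + w)) ≤ sumAll a) (sumSub-⁅⁆ (λ i → a (suc (suc (suc (suc i))))) (fromℕ k))
           (sumSub≤sumAll a (outside ∷ inside ∷ inside ∷ inside ∷ ⁅ fromℕ k ⁆)))
  where
  open SmallestBreaksHalves {suc k} pos count 6a₀≢S 2N≤S
  i₁ i₂ i₃ : Fin (5 + k)
  i₁ = suc zero
  i₂ = suc (suc zero)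
  i₃ = suc (suc (suc zero))
  a₁<a₂ = proj₂ pos i₁ i₂ (s≤s (s≤s z≤n))
  a₂<a₃ = proj₂ pos i₂ i₃ (s≤s (s≤s (s≤s z≤n)))
  S≤6a₁ = QuarterOrSixth⇒≥sixth {a i₁} (QuarterOrSixth-≢u i₁ λ ())

six-elements⇒6a₀≢S : ∀ {k} {a : Fin (6 + k) → ℕ} → IsPosSet a → 6 * a zero ≢ sumAll a
six-elements⇒6a₀≢S {k} {a} pos 6a₀≡S =
  <⇒≱ (size*min<sum pos) (subst (_≤ (6 + k) * a zero) 6a₀≡S (*-monoˡ-≤ (a zero) (m≤m+n 6 k)))

five∧sixth⇒count≢ : ∀ {a : Fin 5 → ℕ} → IsPosSet a → 2 * a (fromℕ 4) ≤ sumAll a → 6 * a zero ≡ sumAll a →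
                    numDivisors a ≢ 2 ^ 4
five∧sixth⇒count≢ {a} pos 2N≤S 6a₀≡S count =
  too-heavy (a zero) (a i₂) (a i₃) (a i₄) (≤-reflexive (sym 6a₀≡S)) (proj₂ pos zero i₂ z<s)
    (QuarterOrSixth⇒≥quarter (≤-reflexive (sym 6a₀≡S)) (proj₂ pos zero i₃ z<s) (QuarterOrSixth-≢u i₃ λ ()))
    2N≡S (subst (λ w → a zero + (a i₂ + (a i₃ + w)) ≤ S) (+-identityʳ (a i₄))
           (sumSub≤sumAll a (inside ∷ outside ∷ inside ∷ inside ∷ inside ∷ [])))
  where
  S = sumAll a
  i₁ i₂ i₃ i₄ : Fin 5
  i₁ = suc zero
  i₂ = suc (suc zero)
  i₃ = suc (suc (suc zero))
  i₄ = suc (suc (suc (suc zero)))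
  24a₁<5S : 2 * 12 * a i₁ < 5 * S
  24a₁<5S = subst₂ _<_ (sym (*-assoc 6 4 (a i₁))) (rest-of-sixth {a zero} {sumAll (a ∘ suc)} 6a₀≡S refl)
                       (*-monoʳ-< 6 (size*min<sum (IsPosSet-tail pos)))
  3a₁<S : 3 * a i₁ < S
  3a₁<S = *-cancelˡ-< 8 (3 * a i₁) S (subst (_< 8 * S) (*-assoc 8 3 (a i₁)) (<-≤-trans 24a₁<5S (*-monoˡ-≤ S (m≤n+m 5 3))))
  S<6a₁ : S < 6 * a i₁
  S<6a₁ = subst (_< 6 * a i₁) 6a₀≡S (*-monoʳ-< 6 (proj₂ pos zero i₁ z<s))
  breaks : PairCount.BreaksHalves a (proj₁ pos) i₁
  breaks = ≤-<-trans (*-monoˡ-≤ (a i₁) (n≤1+n 2)) 3a₁<S , λ d 2[d+a₁]≡S d∣S →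
    ∣⇒≮multiples 3 d∣S (mirror-above-sixth {d} {a i₁} 2[d+a₁]≡S S<6a₁)
      (*-cancelˡ-< 6 S (4 * d) (≤-<-trans (*-monoˡ-≤ S (n≤1+n 6))
        (subst (7 * S <_) (*-assoc 6 4 d) (mirror-below {d} {a i₁} 12 5 7 refl 2[d+a₁]≡S 24a₁<5S))))
  open MaximalCount pos count breaks 3a₁<S (λ 6a₁≡S → <-irrefl (sym 6a₁≡S) S<6a₁) 2N≤S

sixth∧small-top⇒count≢ : ∀ {k} {a : Fin (5 + k) → ℕ} → IsPosSet a → 2 * a (fromℕ (4 + k)) ≤ sumAll a →
                         6 * a zero ≡ sumAll a → numDivisors a ≢ 2 ^ (4 + k)
sixth∧small-top⇒count≢ {zero}  pos 2N≤S 6a₀≡S = five∧sixth⇒count≢ pos 2N≤S 6a₀≡S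
sixth∧small-top⇒count≢ {suc k} pos _    6a₀≡S = ⊥-elim (six-elements⇒6a₀≢S pos 6a₀≡S)

small-top⇒count≢ : ∀ {k} {a : Fin (5 + k) → ℕ} → IsPosSet a → 2 * a (fromℕ (4 + k)) ≤ sumAll a →
                   numDivisors a ≢ 2 ^ (4 + k)
small-top⇒count≢ {k} {a} pos 2N≤S with 6 * a zero ≟ sumAll a
... | no 6a₀≢S  = small-top∧¬sixth⇒count≢ pos 2N≤S 6a₀≢S
... | yes 6a₀≡S = sixth∧small-top⇒count≢ pos 2N≤S 6a₀≡S

Multiple-of-1236 : (Fin 4 → ℕ) → Set
Multiple-of-1236 a = ∃[ c ] (0 < c × a zero ≡ c × a (suc zero) ≡ 2 * c
                             × a (suc (suc zero)) ≡ 3 * c × a (suc (suc (suc zero))) ≡ 6 * c)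

module FourElements {a : Fin 4 → ℕ} (pos : IsPosSet a) (count : numDivisors a ≡ 8)
  (2N≤S : 2 * a (fromℕ 3) ≤ sumAll a) where

  open PairCount a (proj₁ pos)

  private
    i₁ i₂ i₃ : Fin 4
    i₁ = suc zero
    i₂ = suc (suc zero)
    i₃ = suc (suc (suc zero))
    a₀ = a zero
    a₁ = a i₁
    a₂ = a i₂
    a₃ = a i₃
    a₀<a₁ = proj₂ pos zero i₁ z<s
    a₁<a₂ = proj₂ pos i₁ i₂ (s≤s z<s)
    a₂<a₃ = proj₂ pos i₂ i₃ (s≤s (s≤s z<s))
    sum≡S : a₀ + (a₁ + (a₂ + a₃)) ≡ S
    sum≡S = cong (λ w → a₀ + (a₁ + (a₂ + w))) (sym (+-identityʳ a₃))

  ¬sixth⇒Multiple-of-1236 : 6 * a₀ ≢ S → Multiple-of-1236 a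
  ¬sixth⇒Multiple-of-1236 6a₀≢S =
    a₀ , proj₁ pos zero , refl , multiples-of-smallest {a₀} 6a₁≡S 4a₂≡S 2N≡S sum≡S
    where
    open SmallestBreaksHalves {0} pos count 6a₀≢S 2N≤S
    6a₁≡S×S≤4a₂ : 6 * a₁ ≡ S × S ≤ 4 * a₂
    6a₁≡S×S≤4a₂ with QuarterOrSixth-≢u i₁ (λ ())
    ... | inj₁ S≤4a₁ = ⊥-elim (two-quarters-too-heavy a₀ a₁ a₂ a₃ (proj₁ pos zero) S≤4a₁
            (QuarterOrSixth⇒≥quarter (≤-trans S≤4a₁ (*-monoˡ-≤ a₁ (m≤m+n 4 2))) a₁<a₂ (QuarterOrSixth-≢u i₂ λ ()))
            2N≡S (≤-reflexive sum≡S))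
    ... | inj₂ 6a₁≡S = 6a₁≡S , QuarterOrSixth⇒≥quarter (≤-reflexive (sym 6a₁≡S)) a₁<a₂ (QuarterOrSixth-≢u i₂ λ ())
    6a₁≡S = proj₁ 6a₁≡S×S≤4a₂
    3[a₀+a₂]≡S : 3 * (a₀ + a₂) ≡ S
    3[a₀+a₂]≡S = third-of-rest {a₀} {a₁} {a₂} {a₃} 6a₁≡S 2N≡S sum≡S
    3a₂<S : 3 * a₂ < S
    3a₂<S = subst (3 * a₂ <_) 3[a₀+a₂]≡S (*-monoʳ-< 3 (m<n+m a₂ (proj₁ pos zero)))
    -- The divisor {a₀, a₂} of sum S/3 forces {a₂} to be a divisor as well.
    B₂ : Subset 4
    B₂ = outside ∷ outside ∷ inside ∷ outside ∷ []
    pairCount-B₀₂ : pairCount (toggle B₂ zero) ≡ 1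
    pairCount-B₀₂ = cong₂ _+_
      (χ-∣ (toggle B₂ zero) (divides 3 (sym (trans (cong (λ w → 3 * (a₀ + w)) (+-identityʳ a₂)) 3[a₀+a₂]≡S))))
      (χ-∤ (∁ (toggle B₂ zero)) (¬∣-between-half-and-whole
        (subst (_< 2 * (a₁ + (a₃ + 0))) 2N≡S
          (*-monoʳ-< 2 (≤-<-trans (≤-reflexive (sym (+-identityʳ a₃))) (m<n+m (a₃ + 0) (proj₁ pos i₁)))))
        (sum<S (∁ (toggle B₂ zero)) (≤-trans (proj₁ pos zero) (m≤m+n a₀ _)))))
    χ-B₂ : χ B₂ ≡ 1
    χ-B₂ = begin
      χ B₂                 ≡⟨ +-identityʳ (χ B₂) ⟨
      χ B₂ + 0             ≡⟨ cong (χ B₂ +_) (χ-∤ (∁ B₂) (¬∣-between-half-and-whole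
                                (ComplementOf.<half⇒>half B₂ (subst (_< S) (cong (2 *_) (sym (+-identityʳ a₂))) 2a₂<S))
                                (sum-∁<S B₂ (≤-trans (proj₁ pos i₂) (m≤m+n a₂ 0))))) ⟨
      pairCount B₂         ≡⟨ +-cancelʳ-≡ 1 (pairCount B₂) 1
                                (trans (cong (pairCount B₂ +_) (sym pairCount-B₀₂)) (pairCount+toggle≡2 B₂)) ⟩
      1                    ∎
      where
      open ≡-Reasoning
      2a₂<S = ≤-<-trans (*-monoˡ-≤ a₂ (n≤1+n 2)) 3a₂<S
    4a₂≡S : 4 * a₂ ≡ S
    4a₂≡S = ∣-between-quarter-and-third (subst (_∣ S) (+-identityʳ a₂) (χ≡1⇒∣ B₂ χ-B₂)) (proj₂ 6a₁≡S×S≤4a₂) 3a₂<S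

  sixth∧¬quarter⇒⊥ : 6 * a₀ ≡ S → 4 * a₁ ≢ S → Empty
  sixth∧¬quarter⇒⊥ 6a₀≡S 4a₁≢S = too-heavy a₀ a₁ a₂ a₃ (≤-reflexive (sym 6a₀≡S)) a₀<a₁
    (QuarterOrSixth⇒≥quarter (≤-reflexive (sym 6a₀≡S)) (<-trans a₀<a₁ a₁<a₂) (QuarterOrSixth-≢u i₂ λ ()))
    2N≡S (≤-reflexive sum≡S)
    where
    18a₁<5S : 2 * 9 * a₁ < 5 * S
    18a₁<5S = subst₂ _<_ (sym (*-assoc 6 3 a₁)) (rest-of-sixth {a₀} {sumAll (a ∘ suc)} 6a₀≡S refl)
                         (*-monoʳ-< 6 (size*min<sum (IsPosSet-tail pos)))
    3a₁<S : 3 * a₁ < S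
    3a₁<S = *-cancelˡ-< 6 (3 * a₁) S (subst (_< 6 * S) (*-assoc 6 3 a₁) (<-≤-trans 18a₁<5S (*-monoˡ-≤ S (n≤1+n 5))))
    S<6a₁ : S < 6 * a₁
    S<6a₁ = subst (_< 6 * a₁) 6a₀≡S (*-monoʳ-< 6 a₀<a₁)
    breaks : BreaksHalves i₁
    breaks = ≤-<-trans (*-monoˡ-≤ a₁ (n≤1+n 2)) 3a₁<S , λ d 2[d+a₁]≡S d∣S →
      let 3d<S = mirror-above-sixth {d} {a₁} 2[d+a₁]≡S S<6a₁
          S<5d = *-cancelˡ-< 4 S (5 * d) (<-≤-trans (mirror-below {d} {a₁} 9 5 4 refl 2[d+a₁]≡S 18a₁<5S)
                                                     (subst (2 * 9 * d ≤_) (*-assoc 4 5 d) (*-monoˡ-≤ d (m≤m+n 18 2))))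
      in case <-cmp (4 * d) S of λ where
           (tri< 4d<S _ _) → ∣⇒≮multiples 4 d∣S 4d<S S<5d
           (tri≈ _ 4d≡S _) → 4a₁≢S (mirror-quarter {d} {a₁} 2[d+a₁]≡S 4d≡S)
           (tri> _ _ S<4d) → ∣⇒≮multiples 3 d∣S 3d<S S<4d
    open MaximalCount pos count breaks 3a₁<S (λ 6a₁≡S → <-irrefl (sym 6a₁≡S) S<6a₁) 2N≤S

  sixth∧quarter⇒⊥ : 6 * a₀ ≡ S → 4 * a₁ ≡ S → Empty
  sixth∧quarter⇒⊥ 6a₀≡S 4a₁≡S =
    too-heavy a₀ a₂ a₁ a₃ (≤-reflexive (sym 6a₀≡S)) (<-trans a₀<a₁ a₁<a₂) (≤-reflexive (sym 4a₁≡S)) 2N≡S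
    (≤-reflexive (trans (cong (a₀ +_) (x∙yz≈y∙xz a₂ a₁ a₃)) sum≡S))
    where
    24a₂<7S : 2 * 12 * a₂ < 7 * S
    24a₂<7S = subst₂ _<_ (sym (*-assoc 12 2 a₂))
                         (rest-of-sixth-and-quarter {a₀} {a₁} {sumAll (λ i → a (suc (suc i)))} 6a₀≡S 4a₁≡S refl)
                         (*-monoʳ-< 12 (size*min<sum (IsPosSet-tail (IsPosSet-tail pos))))
    3a₂<S : 3 * a₂ < S
    3a₂<S = *-cancelˡ-< 8 (3 * a₂) S (subst (_< 8 * S) (*-assoc 8 3 a₂) (<-≤-trans 24a₂<7S (*-monoˡ-≤ S (n≤1+n 7))))
    S<4a₂ : S < 4 * a₂
    S<4a₂ = subst (_< 4 * a₂) 4a₁≡S (*-monoʳ-< 4 a₁<a₂)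
    S<6a₂ : S < 6 * a₂
    S<6a₂ = <-≤-trans S<4a₂ (*-monoˡ-≤ a₂ (m≤m+n 4 2))
    breaks : BreaksHalves i₂
    breaks = ≤-<-trans (*-monoˡ-≤ a₂ (n≤1+n 2)) 3a₂<S , λ d 2[d+a₂]≡S d∣S →
      ∣⇒≮multiples 4 d∣S (mirror-above-quarter {d} {a₂} 2[d+a₂]≡S S<4a₂)
        (*-cancelˡ-< 5 S (5 * d) (<-≤-trans (mirror-below {d} {a₂} 12 7 5 refl 2[d+a₂]≡S 24a₂<7S)
                                            (subst (2 * 12 * d ≤_) (*-assoc 5 5 d) (*-monoˡ-≤ d (n≤1+n 24)))))
    open MaximalCount pos count breaks 3a₂<S (λ 6a₂≡S → <-irrefl (sym 6a₂≡S) S<6a₂) 2N≤S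

  small-top⇒Multiple-of-1236 : Multiple-of-1236 a
  small-top⇒Multiple-of-1236 with 6 * a₀ ≟ S
  ... | no 6a₀≢S = ¬sixth⇒Multiple-of-1236 6a₀≢S
  ... | yes 6a₀≡S with 4 * a₁ ≟ S
  ...   | no 4a₁≢S  = ⊥-elim (sixth∧¬quarter⇒⊥ 6a₀≡S 4a₁≢S)
  ...   | yes 4a₁≡S = ⊥-elim (sixth∧quarter⇒⊥ 6a₀≡S 4a₁≡S)

-- The sets {a, 2a, 3a, 6a}

sumSub-scaled : ∀ {n} {a : Fin n → ℕ} (w : Fin n → ℕ) c → (∀ i → a i ≡ w i * c) → ∀ B → sumSub a B ≡ sumSub w B * c
sumSub-scaled w c a≡wc []            = refl
sumSub-scaled w c a≡wc (inside ∷ B)  =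
  trans (cong₂ _+_ (a≡wc zero) (sumSub-scaled (w ∘ suc) c (a≡wc ∘ suc) B)) (sym (*-distribʳ-+ c (w zero) _))
sumSub-scaled w c a≡wc (outside ∷ B) = sumSub-scaled (w ∘ suc) c (a≡wc ∘ suc) B

numDivisors-scaled : ∀ {n} {a : Fin n → ℕ} (w : Fin n → ℕ) c .{{_ : NonZero c}} → (∀ i → a i ≡ w i * c) →
                     numDivisors a ≡ numDivisors w
numDivisors-scaled {n} {a} w c a≡wc = begin
  numDivisors a                           ≡⟨ length-filter-allSubsets n (isDivisor? a) ⟩
  Σ-subsets n (indicator (isDivisor? a))  ≡⟨ Σ-subsets-cong n (indicator-cong (isDivisor? a) (isDivisor? w) scaled-∣⇔∣) ⟩
  Σ-subsets n (indicator (isDivisor? w))  ≡⟨ length-filter-allSubsets n (isDivisor? w) ⟨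
  numDivisors w                           ∎
  where
  open ≡-Reasoning
  scaled-∣⇔∣ : ∀ B → IsDivisor a B ⇔ IsDivisor w B
  scaled-∣⇔∣ B rewrite sumSub-scaled w c a≡wc B | sumSub-scaled w c a≡wc (⊤ {n}) = mk⇔ (*-cancelʳ-∣ c) (*-monoˡ-∣ c)

numDivisors-1236 : numDivisors (lookup (1 ∷ 2 ∷ 3 ∷ 6 ∷ [])) ≡ 8
numDivisors-1236 = refl

Multiple-of-1236⇒count : ∀ {a : Fin 4 → ℕ} → Multiple-of-1236 a → numDivisors a ≡ 8
Multiple-of-1236⇒count {a} (c , 0<c , a₀≡c , a₁≡2c , a₂≡3c , a₃≡6c) =
  trans (numDivisors-scaled (lookup (1 ∷ 2 ∷ 3 ∷ 6 ∷ [])) c {{>-nonZero 0<c}} a≡wc) numDivisors-1236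
  where
  a≡wc : ∀ i → a i ≡ lookup (1 ∷ 2 ∷ 3 ∷ 6 ∷ []) i * c
  a≡wc zero                   = trans a₀≡c (sym (*-identityˡ c))
  a≡wc (suc zero)             = a₁≡2c
  a≡wc (suc (suc zero))       = a₂≡3c
  a≡wc (suc (suc (suc zero))) = a₃≡6c

numDivisors≡2^m⇔AntiPencil : ∀ m → 4 ≤ m → (a : Fin (suc m) → ℕ) → IsPosSet a → numDivisors a ≡ 2 ^ m ⇔ AntiPencil a
numDivisors≡2^m⇔AntiPencil .(4 + k) (s≤s (s≤s (s≤s (s≤s (z≤n {k}))))) a pos = mk⇔ to (AntiPencil⇒count pos)
  where
  to : numDivisors a ≡ 2 ^ (4 + k) → AntiPencil a
  to count with sumAll a <? 2 * a (fromℕ (4 + k))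
  ... | yes S<2N = count⇒AntiPencil pos S<2N count
  ... | no S≮2N  = contradiction count (small-top⇒count≢ pos (≮⇒≥ S≮2N))

numDivisors≡8⇔AntiPencil⊎Multiple-of-1236 : (a : Fin 4 → ℕ) → IsPosSet a →
                                             numDivisors a ≡ 8 ⇔ (AntiPencil a ⊎ Multiple-of-1236 a)
numDivisors≡8⇔AntiPencil⊎Multiple-of-1236 a pos = mk⇔ to [ AntiPencil⇒count pos , Multiple-of-1236⇒count {a} ]
  where
  to : numDivisors a ≡ 8 → AntiPencil a ⊎ Multiple-of-1236 a
  to count with sumAll a <? 2 * a (fromℕ 3)
  ... | yes S<2N = inj₁ (count⇒AntiPencil pos S<2N count)
  ... | no S≮2N  = inj₂ (FourElements.small-top⇒Multiple-of-1236 pos count (≮⇒≥ S≮2N))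

mainTheorem15 : ((m : ℕ) → 4 ≤ m → (a : Fin (suc m) → ℕ) → IsPosSet a →
      (numDivisors a ≡ 2 ^ m ⇔ AntiPencil a))
    × ((a : Fin 4 → ℕ) → IsPosSet a →
      (numDivisors a ≡ 8 ⇔
        (AntiPencil a
         ⊎ ∃[ c ] (0 < c × a zero ≡ c × a (suc zero) ≡ 2 * c
                   × a (suc (suc zero)) ≡ 3 * c × a (suc (suc (suc zero))) ≡ 6 * c))))
mainTheorem15 = numDivisors≡2^m⇔AntiPencil , numDivisors≡8⇔AntiPencil⊎Multiple-of-1236
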